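{- Let $n$ be a positive integer and let $d>1$ be a divisor of $n$; put $\lambda=n/d$. Let $\sigma$ be the cycle $(2\,3\,\cdots\,d)$ in the symmetric group on $\{1,\dots,d\}$, and for $0\le i\le d-2$ let $P_i$ be the $d\times d$ permutation matrix of $\sigma^i$. Let $F_i$ be the $n\times n$ matrix obtained from $P_i$ by replacing each entry $0$ by a $\lambda\times\lambda$ block of zeros and each entry $1$ by a $\lambda\times\lambda$ block of ones. Then $\{F_0,\dots,F_{d-2}\}$ is a set of $d-1$ mutually orthogonal binary frequency squares of type $(n;n-\lambda,\lambda)$, and if there is a prime $p$ dividing $d$ that does not divide $\lambda$, then this set is type-maximal.
   Context: A frequency square of type $(n;\lambda_0,\dots,\lambda_{m-1})$ (with $m\ge 2$, all $\lambda_i\ge1$, $\sum\lambda_i=n$) is an $n\times n$ array on symbols $\{0,\dots,m-1\}$ in which symbol $i$ occurs exactly $\lambda_i$ times in each row and each column. It is binary if $m=2$. Two frequency squares $F,F'$ of types $(n;\lambda_0,\dots,\lambda_{m_1-1})$ and $(n;\mu_0,\dots,\mu_{m_2-1})$ are orthogonal if, when superimposed, each ordered pair $(i,j)$ occurs in exactly $\lambda_i\mu_j$ cells. A set of mutually orthogonal frequency squares (MOFS) is a set of frequency squares that are pairwise orthogonal. A set $\{F_1,\dots,F_k\}$ of MOFS is type-maximal if there is no frequency square $F$ that is orthogonal to every $F_i$ and has the same type as some $F_t$. -}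

module Defs where

open import Data.Nat using (ℕ; zero; suc; _+_; _*_; _∸_; _≤_; _<_; _≡ᵇ_)
open import Data.Nat.DivMod using (_/_; _%_)
open import Data.Nat.Divisibility using (_∣_)
open import Data.Nat.Primality using (Prime)
open import Data.Bool using (Bool; true; false; if_then_else_; _∧_)
open import Data.Fin using (Fin; toℕ; _≟_)
open import Data.Vec using (Vec; lookup; sum; _∷_; [])
open import Data.Product using (Σ; _×_; _,_; ∃; ∃-syntax)
open import Relation.Nullary using (¬_)
open import Relation.Nullary.Decidable using (⌊_⌋)
open import Relation.Binary.PropositionalEquality using (_≡_; _≢_)

sumFin : ∀ {n} → (Fin n → ℕ) → ℕ
sumFin {zero}  f = 0
sumFin {suc n} f = f Data.Fin.zero + sumFin (λ k → f (Data.Fin.suc k))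

count : ∀ {n} → (Fin n → Bool) → ℕ
count P = sumFin (λ k → if P k then 1 else 0)

countCells : ∀ {n} → (Fin n → Fin n → Bool) → ℕ
countCells P = sumFin (λ r → count (P r))

-- An n × n array on symbols Fin m together with its claimed type
-- (n; λ_0, …, λ_{m-1}), the λ's stored as a vector.
record Sq (n : ℕ) : Set where
  field
    m   : ℕ
    typ : Vec ℕ m
    arr : Fin n → Fin n → Fin m
open Sq public

typeOf : ∀ {n} → Sq n → Σ ℕ (Vec ℕ)
typeOf F = m F , typ F

IsFreqSquare : ∀ {n} → Sq n → Set
IsFreqSquare {n} F =
  (2 ≤ m F) ×
  (∀ i → 1 ≤ lookup (typ F) i) ×
  (sum (typ F) ≡ n) ×
  (∀ r i → count (λ c → ⌊ arr F r c ≟ i ⌋) ≡ lookup (typ F) i) ×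
  (∀ c i → count (λ r → ⌊ arr F r c ≟ i ⌋) ≡ lookup (typ F) i)

Orthogonal : ∀ {n} → Sq n → Sq n → Set
Orthogonal F G =
  ∀ i j → countCells (λ r c → ⌊ arr F r c ≟ i ⌋ ∧ ⌊ arr G r c ≟ j ⌋)
          ≡ lookup (typ F) i * lookup (typ G) j

IsMOFS : ∀ {n k} → (Fin k → Sq n) → Set
IsMOFS S = (∀ t → IsFreqSquare (S t)) × (∀ s t → s ≢ t → Orthogonal (S s) (S t))

TypeMaximal : ∀ {n k} → (Fin k → Sq n) → Set
TypeMaximal {n} S =
  ¬ (Σ (Sq n) λ F → IsFreqSquare F × (∀ t → Orthogonal F (S t))
                    × ∃[ t ] (typeOf F ≡ typeOf (S t)))

-- x mod k, with the (unused) convention x mod 0 = x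
modN : ℕ → ℕ → ℕ
modN x zero    = x
modN x (suc k) = x % suc k

-- x div k, with the (unused) convention x div 0 = 0
divN : ℕ → ℕ → ℕ
divN x zero    = 0
divN x (suc k) = x / suc k

-- σ^i where σ = (2 3 ⋯ d) on {1,…,d}, written 0-indexed on {0,…,d-1}:
-- σ fixes 0 and maps 1 → 2 → ⋯ → d-1 → 1.
sigmaPow : (d i a : ℕ) → ℕ
sigmaPow d i zero    = zero
sigmaPow d i (suc a) = suc (modN (a + i) (d ∸ 1))

-- entry (a , b) of the permutation matrix P_i of σ^i: 1 iff σ^i(a) = b
-- F_i : the (n × n) blow-up of P_i with λ × λ blocks; symbol 1 for a
-- block of ones, symbol 0 for a block of zeros; type (n; n-λ, λ).
blowUp : (n d lam i : ℕ) → Sq n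
blowUp n d lam i = record
  { m   = 2
  ; typ = (n ∸ lam) ∷ lam ∷ []
  ; arr = λ r c → if sigmaPow d i (divN (toℕ r) lam) ≡ᵇ divN (toℕ c) lam
                  then Data.Fin.suc Data.Fin.zero else Data.Fin.zero
  }

family : (n d lam : ℕ) → Fin (d ∸ 1) → Sq n
family n d lam t = blowUp n d lam (toℕ t)

{-# OPTIONS --safe #-}

-- F_i is the λ-blow-up of the permutation matrix of σ^i, so it is a binary frequency square,
-- and for binary squares orthogonality only depends on the number of cells where both
-- carry a 1.  For s ≠ t the permutations σ^s and σ^t agree only at the fixed point, so
-- F_s and F_t share exactly λ² such cells.
-- For maximality, let X be the 1-indicator of a binary mate G of type (n; n-λ, λ).  The
-- matrices P_0, …, P_{d-2} together with the indicator matrices of the first row and of the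
-- first column add up to d·E₀₀ + J.  Weighting the blow-up of this identity by X
-- gives (d-1)λ² + λ² + λ² = d·M + nλ, with M the number of 1s of G in the top-left block,
-- hence λ² = d·M.  A prime dividing d therefore divides λ.
module Submission where

open import Defs
open import Data.Nat.Properties hiding (_≟_)
open import Algebra.Properties.Semiring.Sum +-*-semiring
  using (sum; sum-syntax; sum-cong-≗; sum-replicate-zero; sum-init-last; ∑-distrib-+; ∑-comm; *-distribˡ-sum; *-distribʳ-sum)
open import Algebra.Properties.CommutativeSemigroup *-commutativeSemigroup using (x∙yz≈y∙xz)
open import Data.Bool using (Bool; true; false; if_then_else_; _∧_)
open import Data.Bool.Properties using (∧-zeroʳ)
open import Data.Empty using (⊥-elim)
open import Data.Fin using (Fin; toℕ; _≟_; inject₁; fromℕ)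
open import Data.Fin.Patterns using (0F; 1F)
open import Data.Fin.Properties using (toℕ<n; toℕ-inject₁; toℕ-fromℕ; toℕ-injective)
open import Data.Nat using (ℕ; zero; suc; _+_; _*_; _∸_; _≤_; _<_; _≡ᵇ_; s≤s; z≤n; NonZero)
open import Data.Nat.DivMod using (_/_; _%_; m≡m%n+[m/n]*n; m<n⇒m%n≡m; m%n<n; %-remove-+ˡ; m<n⇒m/n≡0; m/n≡1+[m∸n]/n; m<n*o⇒m/o<n)
open import Data.Nat.Divisibility using (_∣_; _∤_; divides; ∣-refl; ∣-trans; ∣⇒≤; n∣m*n; ∣m+n∣m⇒∣n)
open import Data.Nat.Primality using (Prime; euclidsLemma)
open import Data.Nat.Tactic.RingSolver using (solve-∀)
open import Data.Product using (_×_; _,_; ∃-syntax)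
open import Data.Sum using ([_,_]; inj₁; inj₂)
open import Data.Vec using (_∷_; []; lookup)
open import Function using (_∘_)
open import Relation.Binary.PropositionalEquality using (_≡_; _≢_; refl; sym; trans; cong; cong₂; subst; module ≡-Reasoning)
open import Relation.Nullary using (contradiction)
open import Relation.Nullary.Decidable using (⌊_⌋)

𝟙 : Bool → ℕ
𝟙 b = if b then 1 else 0

𝟙-∧ : ∀ a b → 𝟙 (a ∧ b) ≡ 𝟙 a * 𝟙 b
𝟙-∧ true  b = sym (+-identityʳ (𝟙 b))
𝟙-∧ false b = refl

sumFin≡sum : ∀ {n} (f : Fin n → ℕ) → sumFin f ≡ sum f
sumFin≡sum {zero}  f = refl
sumFin≡sum {suc n} f = cong (f 0F +_) (sumFin≡sum (f ∘ Fin.suc))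

count≡∑ : ∀ {n} (P : Fin n → Bool) → count P ≡ ∑[ i < n ] 𝟙 (P i)
count≡∑ P = sumFin≡sum (𝟙 ∘ P)

countCells≡∑∑ : ∀ {n} (P : Fin n → Fin n → Bool) →
                countCells P ≡ ∑[ r < n ] ∑[ c < n ] 𝟙 (P r c)
countCells≡∑∑ P = trans (sumFin≡sum (λ r → count (P r))) (sum-cong-≗ (count≡∑ ∘ P))

∑-const : ∀ n c → ∑[ i < n ] c ≡ n * c
∑-const zero    c = refl
∑-const (suc n) c = cong (c +_) (∑-const n c)

∑∑-distrib-+ : ∀ {m n} (f g : Fin m → Fin n → ℕ) →
               ∑[ i < m ] ∑[ j < n ] (f i j + g i j)
                 ≡ ∑[ i < m ] ∑[ j < n ] f i j + ∑[ i < m ] ∑[ j < n ] g i j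
∑∑-distrib-+ {m} f g = trans (sum-cong-≗ {m} (λ i → ∑-distrib-+ (f i) (g i))) (∑-distrib-+ {m} _ _)

∑-split : ∀ m n (h : ℕ → ℕ) →
          ∑[ i < m + n ] h (toℕ i) ≡ ∑[ i < m ] h (toℕ i) + ∑[ j < n ] h (m + toℕ j)
∑-split zero    n h = refl
∑-split (suc m) n h = trans (cong (h 0 +_) (∑-split m n (h ∘ suc))) (sym (+-assoc (h 0) _ _))

∑-blocks : ∀ q d .{{_ : NonZero q}} (g : ℕ → ℕ) →
           ∑[ r < q * d ] g (toℕ r / q) ≡ q * ∑[ a < d ] g (toℕ a)
-- Induction runs over d * q, where suc d * q unfolds to q + d * q.
∑-blocks q d g = subst (λ N → ∑[ r < N ] g (toℕ r / q) ≡ q * ∑[ a < d ] g (toℕ a))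
                       (*-comm d q) (blocks d g)
  where
  [q+x]/q≡1+x/q : ∀ x → (q + x) / q ≡ suc (x / q)
  [q+x]/q≡1+x/q x = trans (m/n≡1+[m∸n]/n (m≤m+n q x)) (cong (suc ∘ (_/ q)) (m+n∸m≡n q x))

  blocks : ∀ d (g : ℕ → ℕ) → ∑[ r < d * q ] g (toℕ r / q) ≡ q * ∑[ a < d ] g (toℕ a)
  blocks zero    g = sym (*-zeroʳ q)
  blocks (suc d) g = begin
    ∑[ r < q + d * q ] g (toℕ r / q)
      ≡⟨ ∑-split q (d * q) (g ∘ (_/ q)) ⟩
    ∑[ r < q ] g (toℕ r / q) + ∑[ r < d * q ] g ((q + toℕ r) / q)
      ≡⟨ cong₂ _+_ (trans (sum-cong-≗ {q} (λ r → cong g (m<n⇒m/n≡0 (toℕ<n r)))) (∑-const q (g 0)))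
                   (trans (sum-cong-≗ {d * q} (λ r → cong g ([q+x]/q≡1+x/q (toℕ r)))) (blocks d (g ∘ suc))) ⟩
    q * g 0 + q * ∑[ a < d ] g (suc (toℕ a))
      ≡⟨ *-distribˡ-+ q _ _ ⟨
    q * ∑[ a < suc d ] g (toℕ a) ∎
    where open ≡-Reasoning

∑∑-blocks : ∀ q d .{{_ : NonZero q}} (h : ℕ → ℕ → ℕ) →
            ∑[ r < q * d ] ∑[ c < q * d ] h (toℕ r / q) (toℕ c / q)
              ≡ q * q * ∑[ a < d ] ∑[ b < d ] h (toℕ a) (toℕ b)
∑∑-blocks q d h = begin
  ∑[ r < q * d ] ∑[ c < q * d ] h (toℕ r / q) (toℕ c / q)
    ≡⟨ sum-cong-≗ {q * d} (λ r → ∑-blocks q d (h (toℕ r / q))) ⟩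
  ∑[ r < q * d ] (q * ∑[ b < d ] h (toℕ r / q) (toℕ b))
    ≡⟨ *-distribˡ-sum {q * d} q (λ r → ∑[ b < d ] h (toℕ r / q) (toℕ b)) ⟨
  q * ∑[ r < q * d ] ∑[ b < d ] h (toℕ r / q) (toℕ b)
    ≡⟨ cong (q *_) (∑-blocks q d (λ a → ∑[ b < d ] h a (toℕ b))) ⟩
  q * (q * ∑[ a < d ] ∑[ b < d ] h (toℕ a) (toℕ b))
    ≡⟨ *-assoc q q _ ⟨
  q * q * ∑[ a < d ] ∑[ b < d ] h (toℕ a) (toℕ b) ∎
  where open ≡-Reasoning

∑-shift : ∀ n (g : ℕ → ℕ) → g n ≡ g 0 → ∑[ i < n ] g (suc (toℕ i)) ≡ ∑[ i < n ] g (toℕ i)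
∑-shift n g gn≡g0 = +-cancelˡ-≡ (g 0) _ _ (begin
  ∑[ i < suc n ] g (toℕ i)
    ≡⟨ sum-init-last (g ∘ toℕ) ⟩
  ∑[ i < n ] g (toℕ (inject₁ i)) + g (toℕ (fromℕ n))
    ≡⟨ cong₂ _+_ (sum-cong-≗ {n} (cong g ∘ toℕ-inject₁)) (trans (cong g (toℕ-fromℕ n)) gn≡g0) ⟩
  ∑[ i < n ] g (toℕ i) + g 0
    ≡⟨ +-comm _ (g 0) ⟩
  g 0 + ∑[ i < n ] g (toℕ i) ∎)
  where open ≡-Reasoning

∑-rotate : ∀ n .{{_ : NonZero n}} x (h : ℕ → ℕ) →
           ∑[ i < n ] h ((toℕ i + x) % n) ≡ ∑[ i < n ] h (toℕ i)
∑-rotate n zero    h = sum-cong-≗ {n} λ i →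
  cong h (trans (cong (_% n) (+-identityʳ (toℕ i))) (m<n⇒m%n≡m (toℕ<n i)))
∑-rotate n (suc x) h = begin
  ∑[ i < n ] h ((toℕ i + suc x) % n)
    ≡⟨ sum-cong-≗ {n} (λ i → cong (h ∘ (_% n)) (+-suc (toℕ i) x)) ⟩
  ∑[ i < n ] h ((suc (toℕ i) + x) % n)
    ≡⟨ ∑-shift n (λ y → h ((y + x) % n)) (cong h (%-remove-+ˡ x ∣-refl)) ⟩
  ∑[ i < n ] h ((toℕ i + x) % n)
    ≡⟨ ∑-rotate n x h ⟩
  ∑[ i < n ] h (toℕ i) ∎
  where open ≡-Reasoning

≡ᵇ-comm : ∀ m n → (m ≡ᵇ n) ≡ (n ≡ᵇ m)
≡ᵇ-comm zero    zero    = refl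
≡ᵇ-comm zero    (suc n) = refl
≡ᵇ-comm (suc m) zero    = refl
≡ᵇ-comm (suc m) (suc n) = ≡ᵇ-comm m n

𝟙-≡ᵇ-≢ : ∀ {m n} → m ≢ n → 𝟙 (m ≡ᵇ n) ≡ 0
𝟙-≡ᵇ-≢ {zero}  {zero}  m≢n = ⊥-elim (m≢n refl)
𝟙-≡ᵇ-≢ {zero}  {suc n} _   = refl
𝟙-≡ᵇ-≢ {suc m} {zero}  _   = refl
𝟙-≡ᵇ-≢ {suc m} {suc n} m≢n = 𝟙-≡ᵇ-≢ (m≢n ∘ cong suc)

∑-𝟙-≡ᵇ : ∀ {d v} → v < d → ∑[ b < d ] 𝟙 (v ≡ᵇ toℕ b) ≡ 1
∑-𝟙-≡ᵇ {suc d} {zero}  _         = cong suc (sum-replicate-zero d)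
∑-𝟙-≡ᵇ {suc d} {suc v} (s≤s v<d) = ∑-𝟙-≡ᵇ v<d

∑-𝟙-≡ᵇ-∧ : ∀ {d} u v → u < d → ∑[ b < d ] 𝟙 ((u ≡ᵇ toℕ b) ∧ (v ≡ᵇ toℕ b)) ≡ 𝟙 (u ≡ᵇ v)
∑-𝟙-≡ᵇ-∧ {suc d} zero    zero    _ = cong suc (sum-replicate-zero d)
∑-𝟙-≡ᵇ-∧ {suc d} zero    (suc v) _ = sum-replicate-zero d
∑-𝟙-≡ᵇ-∧ {suc d} (suc u) zero    _ =
  trans (sum-cong-≗ {d} (λ b → cong 𝟙 (∧-zeroʳ (u ≡ᵇ toℕ b)))) (sum-replicate-zero d)
∑-𝟙-≡ᵇ-∧ {suc d} (suc u) (suc v) (s≤s u<d) = ∑-𝟙-≡ᵇ-∧ u v u<d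

∑-𝟙-rotate : ∀ n .{{_ : NonZero n}} x {b} → b < n → ∑[ i < n ] 𝟙 ((toℕ i + x) % n ≡ᵇ b) ≡ 1
∑-𝟙-rotate n x {b} b<n = begin
  ∑[ i < n ] 𝟙 ((toℕ i + x) % n ≡ᵇ b) ≡⟨ ∑-rotate n x (λ y → 𝟙 (y ≡ᵇ b)) ⟩
  ∑[ i < n ] 𝟙 (toℕ i ≡ᵇ b)           ≡⟨ sum-cong-≗ {n} (λ i → cong 𝟙 (≡ᵇ-comm (toℕ i) b)) ⟩
  ∑[ i < n ] 𝟙 (b ≡ᵇ toℕ i)           ≡⟨ ∑-𝟙-≡ᵇ b<n ⟩
  1                                   ∎
  where open ≡-Reasoning

[m+n]%o≡m%o⇒o∣n : ∀ m n {o} .{{_ : NonZero o}} → (m + n) % o ≡ m % o → o ∣ n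
[m+n]%o≡m%o⇒o∣n m n {o} eq = ∣m+n∣m⇒∣n (divides ((m + n) / o) (+-cancelˡ-≡ (m % o) _ _ (begin
  m % o + (m / o * o + n)         ≡⟨ +-assoc (m % o) _ n ⟨
  m % o + m / o * o + n           ≡⟨ cong (_+ n) (m≡m%n+[m/n]*n m o) ⟨
  m + n                           ≡⟨ m≡m%n+[m/n]*n (m + n) o ⟩
  (m + n) % o + (m + n) / o * o   ≡⟨ cong (_+ (m + n) / o * o) eq ⟩
  m % o + (m + n) / o * o         ∎))) (n∣m*n (m / o))
  where open ≡-Reasoning

∣∧<⇒≡0 : ∀ {m n} → m ∣ n → n < m → n ≡ 0
∣∧<⇒≡0 {n = zero}  _   _   = refl
∣∧<⇒≡0 {n = suc n} m∣n n<m = contradiction (∣⇒≤ m∣n) (<⇒≱ n<m)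

+-cancelˡ-≡-%-≤ : ∀ m {n o p} .{{_ : NonZero p}} → n ≤ o → o < p → (m + n) % p ≡ (m + o) % p → n ≡ o
+-cancelˡ-≡-%-≤ m {n} {o} n≤o o<p eq = begin
  n             ≡⟨ +-identityʳ n ⟨
  n + 0         ≡⟨ cong (n +_) o∸n≡0 ⟨
  n + (o ∸ n)   ≡⟨ m+[n∸m]≡n n≤o ⟩
  o             ∎
  where
  open ≡-Reasoning
  m+o≡m+n+[o∸n] : m + o ≡ m + n + (o ∸ n)
  m+o≡m+n+[o∸n] = trans (cong (m +_) (sym (m+[n∸m]≡n n≤o))) (sym (+-assoc m n (o ∸ n)))
  o∸n≡0 : o ∸ n ≡ 0
  o∸n≡0 = ∣∧<⇒≡0 ([m+n]%o≡m%o⇒o∣n (m + n) (o ∸ n) (trans (cong (_% _) (sym m+o≡m+n+[o∸n])) (sym eq)))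
                 (≤-<-trans (m∸n≤m o n) o<p)

+-cancelˡ-≡-% : ∀ m {n o p} .{{_ : NonZero p}} → n < p → o < p → (m + n) % p ≡ (m + o) % p → n ≡ o
+-cancelˡ-≡-% m {n} {o} n<p o<p eq with ≤-total n o
... | inj₁ n≤o = +-cancelˡ-≡-%-≤ m n≤o o<p eq
... | inj₂ o≤n = sym (+-cancelˡ-≡-%-≤ m o≤n n<p (sym eq))

countCells-+ : ∀ {n} {P Q R : Fin n → Fin n → Bool} → (∀ r c → 𝟙 (P r c) + 𝟙 (Q r c) ≡ 𝟙 (R r c)) →
               countCells P + countCells Q ≡ countCells R
countCells-+ {n} {P} {Q} {R} pointwise = begin
  countCells P + countCells Q
    ≡⟨ cong₂ _+_ (countCells≡∑∑ P) (countCells≡∑∑ Q) ⟩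
  ∑[ r < n ] ∑[ c < n ] 𝟙 (P r c) + ∑[ r < n ] ∑[ c < n ] 𝟙 (Q r c)
    ≡⟨ ∑∑-distrib-+ (λ r c → 𝟙 (P r c)) (λ r c → 𝟙 (Q r c)) ⟨
  ∑[ r < n ] ∑[ c < n ] (𝟙 (P r c) + 𝟙 (Q r c))
    ≡⟨ sum-cong-≗ {n} (λ r → sum-cong-≗ {n} (pointwise r)) ⟩
  ∑[ r < n ] ∑[ c < n ] 𝟙 (R r c)
    ≡⟨ countCells≡∑∑ R ⟨
  countCells R ∎
  where open ≡-Reasoning

countCells-rows : ∀ {n ℓ} (P : Fin n → Fin n → Bool) → (∀ r → count (P r) ≡ ℓ) → countCells P ≡ n * ℓ
countCells-rows {n} {ℓ} P rows =
  trans (sumFin≡sum (count ∘ P)) (trans (sum-cong-≗ {n} rows) (∑-const n ℓ))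

binarySq : ∀ {n} → ℕ → ℕ → (Fin n → Fin n → Fin 2) → Sq n
binarySq ℓ₀ ℓ₁ A = record { m = 2 ; typ = ℓ₀ ∷ ℓ₁ ∷ [] ; arr = A }

𝟙-≟0F+𝟙-≟1F : ∀ (x : Fin 2) → 𝟙 ⌊ x ≟ 0F ⌋ + 𝟙 ⌊ x ≟ 1F ⌋ ≡ 1
𝟙-≟0F+𝟙-≟1F 0F = refl
𝟙-≟0F+𝟙-≟1F 1F = refl

count-≟0F+count-≟1F : ∀ {n} (x : Fin n → Fin 2) →
                      count (λ i → ⌊ x i ≟ 0F ⌋) + count (λ i → ⌊ x i ≟ 1F ⌋) ≡ n
count-≟0F+count-≟1F {n} x = begin
  count (λ i → ⌊ x i ≟ 0F ⌋) + count (λ i → ⌊ x i ≟ 1F ⌋)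
    ≡⟨ cong₂ _+_ (count≡∑ (λ i → ⌊ x i ≟ 0F ⌋)) (count≡∑ (λ i → ⌊ x i ≟ 1F ⌋)) ⟩
  ∑[ i < n ] 𝟙 ⌊ x i ≟ 0F ⌋ + ∑[ i < n ] 𝟙 ⌊ x i ≟ 1F ⌋
    ≡⟨ ∑-distrib-+ (λ i → 𝟙 ⌊ x i ≟ 0F ⌋) (λ i → 𝟙 ⌊ x i ≟ 1F ⌋) ⟨
  ∑[ i < n ] (𝟙 ⌊ x i ≟ 0F ⌋ + 𝟙 ⌊ x i ≟ 1F ⌋)
    ≡⟨ sum-cong-≗ {n} (𝟙-≟0F+𝟙-≟1F ∘ x) ⟩
  ∑[ i < n ] 1
    ≡⟨ trans (∑-const n 1) (*-identityʳ n) ⟩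
  n ∎
  where open ≡-Reasoning

binary-isFreqSquare : ∀ {n ℓ} (A : Fin n → Fin n → Fin 2) → 0 < ℓ → ℓ < n →
  (∀ r → count (λ c → ⌊ A r c ≟ 1F ⌋) ≡ ℓ) → (∀ c → count (λ r → ⌊ A r c ≟ 1F ⌋) ≡ ℓ) →
  IsFreqSquare (binarySq (n ∸ ℓ) ℓ A)
binary-isFreqSquare {n} {ℓ} A 0<ℓ ℓ<n rows cols =
  s≤s (s≤s z≤n) , positive , total , (λ r → line (rows r)) , (λ c → line (cols c))
  where
  positive : ∀ i → 1 ≤ lookup ((n ∸ ℓ) ∷ ℓ ∷ []) i
  positive 0F = m<n⇒0<n∸m ℓ<n
  positive 1F = 0<ℓ

  total : n ∸ ℓ + (ℓ + 0) ≡ n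
  total = trans (cong (n ∸ ℓ +_) (+-identityʳ ℓ)) (m∸n+n≡m (<⇒≤ ℓ<n))

  line : ∀ {x : Fin n → Fin 2} → count (λ i → ⌊ x i ≟ 1F ⌋) ≡ ℓ →
         ∀ j → count (λ i → ⌊ x i ≟ j ⌋) ≡ lookup ((n ∸ ℓ) ∷ ℓ ∷ []) j
  line {x} ones 0F = begin
    count (λ i → ⌊ x i ≟ 0F ⌋)
      ≡⟨ m+n∸n≡m _ ℓ ⟨
    count (λ i → ⌊ x i ≟ 0F ⌋) + ℓ ∸ ℓ
      ≡⟨ cong (λ y → count (λ i → ⌊ x i ≟ 0F ⌋) + y ∸ ℓ) ones ⟨
    count (λ i → ⌊ x i ≟ 0F ⌋) + count (λ i → ⌊ x i ≟ 1F ⌋) ∸ ℓ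
      ≡⟨ cong (_∸ ℓ) (count-≟0F+count-≟1F x) ⟩
    n ∸ ℓ ∎
    where open ≡-Reasoning
  line ones 1F = ones

binary-orthogonal : ∀ {n ℓ₀ ℓ₁ μ₀ μ₁} (A B : Fin n → Fin n → Fin 2) →
  IsFreqSquare (binarySq ℓ₀ ℓ₁ A) → IsFreqSquare (binarySq μ₀ μ₁ B) →
  countCells (λ r c → ⌊ A r c ≟ 1F ⌋ ∧ ⌊ B r c ≟ 1F ⌋) ≡ ℓ₁ * μ₁ →
  Orthogonal (binarySq ℓ₀ ℓ₁ A) (binarySq μ₀ μ₁ B)
binary-orthogonal {n} {ℓ₀} {ℓ₁} {μ₀} {μ₁} A B (_ , _ , totalA , rowsA , _) (_ , _ , totalB , rowsB , _) N₁₁ =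
  orthogonal
  where
  open ≡-Reasoning

  N : Fin 2 → Fin 2 → ℕ
  N i j = countCells (λ r c → ⌊ A r c ≟ i ⌋ ∧ ⌊ B r c ≟ j ⌋)

  split-right : ∀ b (y : Fin 2) → 𝟙 (b ∧ ⌊ y ≟ 0F ⌋) + 𝟙 (b ∧ ⌊ y ≟ 1F ⌋) ≡ 𝟙 b
  split-right true  y = 𝟙-≟0F+𝟙-≟1F y
  split-right false y = refl

  split-left : ∀ (x : Fin 2) b → 𝟙 (⌊ x ≟ 0F ⌋ ∧ b) + 𝟙 (⌊ x ≟ 1F ⌋ ∧ b) ≡ 𝟙 b
  split-left 0F b = +-identityʳ (𝟙 b)
  split-left 1F b = refl

  rowMarginal : ∀ i → N i 0F + N i 1F ≡ n * lookup (ℓ₀ ∷ ℓ₁ ∷ []) i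
  rowMarginal i = trans (countCells-+ (λ r c → split-right ⌊ A r c ≟ i ⌋ (B r c)))
                        (countCells-rows _ (λ r → rowsA r i))

  colMarginal : ∀ j → N 0F j + N 1F j ≡ n * lookup (μ₀ ∷ μ₁ ∷ []) j
  colMarginal j = trans (countCells-+ (λ r c → split-left (A r c) ⌊ B r c ≟ j ⌋))
                        (countCells-rows _ (λ r → rowsB r j))

  n*ℓ≡ℓ*μ₀+ℓ*μ₁ : ∀ ℓ → n * ℓ ≡ ℓ * μ₀ + ℓ * μ₁
  n*ℓ≡ℓ*μ₀+ℓ*μ₁ ℓ = begin
    n * ℓ               ≡⟨ *-comm n ℓ ⟩
    ℓ * n               ≡⟨ cong (ℓ *_) totalB ⟨
    ℓ * (μ₀ + (μ₁ + 0)) ≡⟨ cong (λ x → ℓ * (μ₀ + x)) (+-identityʳ μ₁) ⟩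
    ℓ * (μ₀ + μ₁)       ≡⟨ *-distribˡ-+ ℓ μ₀ μ₁ ⟩
    ℓ * μ₀ + ℓ * μ₁     ∎

  n*μ≡ℓ₀*μ+ℓ₁*μ : ∀ μ → n * μ ≡ ℓ₀ * μ + ℓ₁ * μ
  n*μ≡ℓ₀*μ+ℓ₁*μ μ = begin
    n * μ               ≡⟨ cong (_* μ) totalA ⟨
    (ℓ₀ + (ℓ₁ + 0)) * μ ≡⟨ cong (λ x → (ℓ₀ + x) * μ) (+-identityʳ ℓ₁) ⟩
    (ℓ₀ + ℓ₁) * μ       ≡⟨ *-distribʳ-+ μ ℓ₀ ℓ₁ ⟩
    ℓ₀ * μ + ℓ₁ * μ     ∎

  cancel : ∀ {x y u v} → x + y ≡ u + v → y ≡ v → x ≡ u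
  cancel {y = y} eq refl = +-cancelʳ-≡ y _ _ eq

  orthogonal : Orthogonal (binarySq ℓ₀ ℓ₁ A) (binarySq μ₀ μ₁ B)
  orthogonal 1F 1F = N₁₁
  orthogonal 1F 0F = cancel (trans (rowMarginal 1F) (n*ℓ≡ℓ*μ₀+ℓ*μ₁ ℓ₁)) N₁₁
  orthogonal 0F 1F = cancel (trans (colMarginal 1F) (n*μ≡ℓ₀*μ+ℓ₁*μ μ₁)) N₁₁
  orthogonal 0F 0F = cancel (trans (rowMarginal 0F) (n*ℓ≡ℓ*μ₀+ℓ*μ₁ ℓ₀)) (orthogonal 0F 1F)

bit : Bool → Fin 2
bit b = if b then 1F else 0F

bit-≟-1F : ∀ b → ⌊ bit b ≟ 1F ⌋ ≡ b
bit-≟-1F true  = refl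
bit-≟-1F false = refl

count-ones : ∀ {m} (P : Fin m → Bool) → count (λ c → ⌊ bit (P c) ≟ 1F ⌋) ≡ ∑[ c < m ] 𝟙 (P c)
count-ones {m} P = trans (count≡∑ (λ c → ⌊ bit (P c) ≟ 1F ⌋)) (sum-cong-≗ {m} (cong 𝟙 ∘ bit-≟-1F ∘ P))

weighted : ∀ {n} → (Fin n → Fin n → ℕ) → (Fin n → Fin n → ℕ) → ℕ
weighted {n} X w = ∑[ r < n ] ∑[ c < n ] (X r c * w r c)

module _ {n} (X : Fin n → Fin n → ℕ) where

  weighted-+ : ∀ v w → weighted X (λ r c → v r c + w r c) ≡ weighted X v + weighted X w
  weighted-+ v w = trans (sum-cong-≗ {n} (λ r → sum-cong-≗ {n} (λ c → *-distribˡ-+ (X r c) (v r c) (w r c))))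
                         (∑∑-distrib-+ (λ r c → X r c * v r c) (λ r c → X r c * w r c))

  weighted-* : ∀ a w → weighted X (λ r c → a * w r c) ≡ a * weighted X w
  weighted-* a w = begin
    ∑[ r < n ] ∑[ c < n ] (X r c * (a * w r c))
      ≡⟨ sum-cong-≗ {n} (λ r → sum-cong-≗ {n} (λ c → x∙yz≈y∙xz (X r c) a (w r c))) ⟩
    ∑[ r < n ] ∑[ c < n ] (a * (X r c * w r c))
      ≡⟨ sum-cong-≗ {n} (λ r → *-distribˡ-sum {n} a (λ c → X r c * w r c)) ⟨
    ∑[ r < n ] (a * ∑[ c < n ] (X r c * w r c))
      ≡⟨ *-distribˡ-sum {n} a (λ r → ∑[ c < n ] (X r c * w r c)) ⟨
    a * weighted X w ∎
    where open ≡-Reasoning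

  weighted-∑ : ∀ {m} (w : Fin m → Fin n → Fin n → ℕ) →
               weighted X (λ r c → ∑[ t < m ] w t r c) ≡ ∑[ t < m ] weighted X (w t)
  weighted-∑ {m} w = begin
    ∑[ r < n ] ∑[ c < n ] (X r c * ∑[ t < m ] w t r c)
      ≡⟨ sum-cong-≗ {n} (λ r → sum-cong-≗ {n} (λ c → *-distribˡ-sum {m} (X r c) (λ t → w t r c))) ⟩
    ∑[ r < n ] ∑[ c < n ] ∑[ t < m ] (X r c * w t r c)
      ≡⟨ sum-cong-≗ {n} (λ r → ∑-comm (λ c t → X r c * w t r c)) ⟩
    ∑[ r < n ] ∑[ t < m ] ∑[ c < n ] (X r c * w t r c)
      ≡⟨ ∑-comm (λ r t → ∑[ c < n ] (X r c * w t r c)) ⟩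
    ∑[ t < m ] weighted X (w t) ∎
    where open ≡-Reasoning

  weighted-row : ∀ {s} → (∀ r → ∑[ c < n ] X r c ≡ s) → (u : Fin n → ℕ) →
                 weighted X (λ r c → u r) ≡ s * ∑[ r < n ] u r
  weighted-row {s} rows u = begin
    ∑[ r < n ] ∑[ c < n ] (X r c * u r)
      ≡⟨ sum-cong-≗ {n} (λ r → *-distribʳ-sum {n} (u r) (X r)) ⟨
    ∑[ r < n ] (∑[ c < n ] X r c * u r)
      ≡⟨ sum-cong-≗ {n} (λ r → cong (_* u r) (rows r)) ⟩
    ∑[ r < n ] (s * u r)
      ≡⟨ *-distribˡ-sum {n} s u ⟨
    s * ∑[ r < n ] u r ∎
    where open ≡-Reasoning

weighted-col : ∀ {n s} (X : Fin n → Fin n → ℕ) → (∀ c → ∑[ r < n ] X r c ≡ s) → (u : Fin n → ℕ) →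
               weighted X (λ r c → u c) ≡ s * ∑[ c < n ] u c
weighted-col X cols u = trans (∑-comm (λ r c → X r c * u c)) (weighted-row (λ c r → X r c) cols u)

module Cycle (k : ℕ) where

  d : ℕ
  d = suc (suc k)

  σ : ℕ → ℕ → ℕ
  σ = sigmaPow d

  σ-< : ∀ i {a} → a < d → σ i a < d
  σ-< i {zero}  _ = s≤s z≤n
  σ-< i {suc a} _ = s≤s (m%n<n (a + i) (suc k))

  ∑-𝟙-σ-col : ∀ i {b} → b < d → ∑[ a < d ] 𝟙 (σ i (toℕ a) ≡ᵇ b) ≡ 1
  ∑-𝟙-σ-col i {zero}  _         = cong suc (sum-replicate-zero (suc k))
  ∑-𝟙-σ-col i {suc b} (s≤s b<d) = ∑-𝟙-rotate (suc k) i b<d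

  ∑-𝟙-σ-agree : ∀ {s t} → s < suc k → t < suc k → s ≢ t → ∑[ a < d ] 𝟙 (σ s (toℕ a) ≡ᵇ σ t (toℕ a)) ≡ 1
  ∑-𝟙-σ-agree s<k t<k s≢t = cong suc (trans
    (sum-cong-≗ {suc k} (λ a → 𝟙-≡ᵇ-≢ (s≢t ∘ +-cancelˡ-≡-% (toℕ a) s<k t<k)))
    (sum-replicate-zero (suc k)))

  -- σ^t (t < d-1) maps 0 to 0 and acts on 1, …, d-1 as the powers of a (d-1)-cycle, so each
  -- (a , b) with a, b ≠ 0 lies on exactly one of the P_t, and (0 , 0) on all of them.
  σ-identity : ∀ {a b} → a < d → b < d →
    ∑[ t < suc k ] 𝟙 (σ (toℕ t) a ≡ᵇ b) + 𝟙 (0 ≡ᵇ a) + 𝟙 (0 ≡ᵇ b) ≡ d * (𝟙 (0 ≡ᵇ a) * 𝟙 (0 ≡ᵇ b)) + 1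
  σ-identity {zero}  {zero}  _ _ =
    trans (cong (λ y → y + 1 + 1) (∑-const (suc k) 1)) (cong suc (+-comm (k * 1 + 1) 1))
  σ-identity {zero}  {suc b} _ _ =
    trans (cong (λ y → y + 1 + 0) (sum-replicate-zero (suc k))) (cong (_+ 1) (sym (*-zeroʳ d)))
  σ-identity {suc a} {zero}  _ _ =
    trans (cong (λ y → y + 0 + 1) (sum-replicate-zero (suc k))) (cong (_+ 1) (sym (*-zeroʳ d)))
  σ-identity {suc a} {suc b} _ (s≤s b<d) = begin
    ∑[ t < suc k ] 𝟙 ((a + toℕ t) % suc k ≡ᵇ b) + 0 + 0
      ≡⟨ trans (+-identityʳ _) (+-identityʳ _) ⟩
    ∑[ t < suc k ] 𝟙 ((a + toℕ t) % suc k ≡ᵇ b)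
      ≡⟨ sum-cong-≗ {suc k} (λ t → cong (λ x → 𝟙 (x % suc k ≡ᵇ b)) (+-comm a (toℕ t))) ⟩
    ∑[ t < suc k ] 𝟙 ((toℕ t + a) % suc k ≡ᵇ b)
      ≡⟨ ∑-𝟙-rotate (suc k) a b<d ⟩
    1
      ≡⟨ cong (_+ 1) (*-zeroʳ d) ⟨
    d * 0 + 1 ∎
    where open ≡-Reasoning

module BlowUp (q′ k : ℕ) where

  open Cycle k

  q n : ℕ
  q = suc q′
  n = q * d

  F : ℕ → Sq n
  F = blowUp n d q

  ones : ℕ → Fin n → Fin n → Bool
  ones i r c = σ i (toℕ r / q) ≡ᵇ toℕ c / q

  block-< : (r : Fin n) → toℕ r / q < d
  block-< r = m<n*o⇒m/o<n (subst (toℕ r <_) (*-comm q d) (toℕ<n r))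

  isFreqSquare-F : ∀ i → IsFreqSquare (F i)
  isFreqSquare-F i = binary-isFreqSquare (arr (F i)) (s≤s z≤n) (m<m*n q d (s≤s (s≤s z≤n))) row col
    where
    open ≡-Reasoning
    row : ∀ r → count (λ c → ⌊ arr (F i) r c ≟ 1F ⌋) ≡ q
    row r = begin
      count (λ c → ⌊ arr (F i) r c ≟ 1F ⌋)           ≡⟨ count-ones (ones i r) ⟩
      ∑[ c < n ] 𝟙 (σ i (toℕ r / q) ≡ᵇ toℕ c / q)    ≡⟨ ∑-blocks q d (λ b → 𝟙 (σ i (toℕ r / q) ≡ᵇ b)) ⟩
      q * ∑[ b < d ] 𝟙 (σ i (toℕ r / q) ≡ᵇ toℕ b)    ≡⟨ cong (q *_) (∑-𝟙-≡ᵇ (σ-< i (block-< r))) ⟩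
      q * 1                                         ≡⟨ *-identityʳ q ⟩
      q                                             ∎
    col : ∀ c → count (λ r → ⌊ arr (F i) r c ≟ 1F ⌋) ≡ q
    col c = begin
      count (λ r → ⌊ arr (F i) r c ≟ 1F ⌋)           ≡⟨ count-ones (λ r → ones i r c) ⟩
      ∑[ r < n ] 𝟙 (σ i (toℕ r / q) ≡ᵇ toℕ c / q)    ≡⟨ ∑-blocks q d (λ a → 𝟙 (σ i a ≡ᵇ toℕ c / q)) ⟩
      q * ∑[ a < d ] 𝟙 (σ i (toℕ a) ≡ᵇ toℕ c / q)    ≡⟨ cong (q *_) (∑-𝟙-σ-col i (block-< c)) ⟩
      q * 1                                         ≡⟨ *-identityʳ q ⟩
      q                                             ∎

  overlap-F : ∀ {s t} → s < suc k → t < suc k → s ≢ t →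
              countCells (λ r c → ⌊ arr (F s) r c ≟ 1F ⌋ ∧ ⌊ arr (F t) r c ≟ 1F ⌋) ≡ q * q
  overlap-F {s} {t} s<k t<k s≢t = begin
    countCells (λ r c → ⌊ arr (F s) r c ≟ 1F ⌋ ∧ ⌊ arr (F t) r c ≟ 1F ⌋)
      ≡⟨ countCells≡∑∑ (λ r c → ⌊ arr (F s) r c ≟ 1F ⌋ ∧ ⌊ arr (F t) r c ≟ 1F ⌋) ⟩
    ∑[ r < n ] ∑[ c < n ] 𝟙 (⌊ arr (F s) r c ≟ 1F ⌋ ∧ ⌊ arr (F t) r c ≟ 1F ⌋)
      ≡⟨ sum-cong-≗ {n} (λ r → sum-cong-≗ {n} (λ c →
           cong₂ (λ x y → 𝟙 (x ∧ y)) (bit-≟-1F (ones s r c)) (bit-≟-1F (ones t r c)))) ⟩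
    ∑[ r < n ] ∑[ c < n ] 𝟙 (ones s r c ∧ ones t r c)
      ≡⟨ ∑∑-blocks q d (λ a b → 𝟙 ((σ s a ≡ᵇ b) ∧ (σ t a ≡ᵇ b))) ⟩
    q * q * ∑[ a < d ] ∑[ b < d ] 𝟙 ((σ s (toℕ a) ≡ᵇ toℕ b) ∧ (σ t (toℕ a) ≡ᵇ toℕ b))
      ≡⟨ cong (q * q *_) (sum-cong-≗ {d} (λ a →
           ∑-𝟙-≡ᵇ-∧ (σ s (toℕ a)) (σ t (toℕ a)) (σ-< s (toℕ<n a)))) ⟩
    q * q * ∑[ a < d ] 𝟙 (σ s (toℕ a) ≡ᵇ σ t (toℕ a))
      ≡⟨ cong (q * q *_) (∑-𝟙-σ-agree s<k t<k s≢t) ⟩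
    q * q * 1
      ≡⟨ *-identityʳ (q * q) ⟩
    q * q ∎
    where open ≡-Reasoning

  orthogonal-F : ∀ {s t} → s < suc k → t < suc k → s ≢ t → Orthogonal (F s) (F t)
  orthogonal-F s<k t<k s≢t =
    binary-orthogonal (arr (F _)) (arr (F _)) (isFreqSquare-F _) (isFreqSquare-F _) (overlap-F s<k t<k s≢t)

  in-first-block : Fin n → ℕ
  in-first-block r = 𝟙 (0 ≡ᵇ toℕ r / q)

  ∑-in-first-block : ∑[ r < n ] in-first-block r ≡ q
  ∑-in-first-block = trans (∑-blocks q d (λ a → 𝟙 (0 ≡ᵇ a)))
                           (trans (cong (q *_) (∑-𝟙-≡ᵇ {d} (s≤s z≤n))) (*-identityʳ q))

  d∣q*q : (X : Fin n → Fin n → ℕ) → (∀ r → ∑[ c < n ] X r c ≡ q) → (∀ c → ∑[ r < n ] X r c ≡ q) →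
          (∀ (t : Fin (suc k)) → weighted X (λ r c → 𝟙 (ones (toℕ t) r c)) ≡ q * q) → d ∣ q * q
  d∣q*q X rows cols overlaps = divides M (trans q*q≡d*M (*-comm d M))
    where
    open ≡-Reasoning
    Z = in-first-block
    M = weighted X (λ r c → Z r * Z c)

    all-ones : Fin n → Fin n → ℕ
    all-ones r c = ∑[ t < suc k ] 𝟙 (ones (toℕ t) r c)

    W : Fin n → Fin n → ℕ
    W r c = all-ones r c + Z r + Z c

    [1+k]*x+x+x≡x+[2+k]*x : ∀ k x → suc k * x + x + x ≡ x + suc (suc k) * x
    [1+k]*x+x+x≡x+[2+k]*x = solve-∀

    q*[q*d*1]≡d*[q*q] : ∀ q d → q * (q * d * 1) ≡ d * (q * q)
    q*[q*d*1]≡d*[q*q] = solve-∀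

    weighted-all-ones : weighted X all-ones ≡ suc k * (q * q)
    weighted-all-ones = begin
      weighted X all-ones
        ≡⟨ weighted-∑ X {suc k} (λ t r c → 𝟙 (ones (toℕ t) r c)) ⟩
      ∑[ t < suc k ] weighted X (λ r c → 𝟙 (ones (toℕ t) r c))
        ≡⟨ sum-cong-≗ {suc k} overlaps ⟩
      ∑[ t < suc k ] (q * q)
        ≡⟨ ∑-const (suc k) (q * q) ⟩
      suc k * (q * q) ∎

    by-overlaps : weighted X W ≡ q * q + d * (q * q)
    by-overlaps = begin
      weighted X W
        ≡⟨ trans (weighted-+ X (λ r c → all-ones r c + Z r) (λ r c → Z c))
                 (cong (_+ weighted X (λ r c → Z c)) (weighted-+ X all-ones (λ r c → Z r))) ⟩
      weighted X all-ones + weighted X (λ r c → Z r) + weighted X (λ r c → Z c)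
        ≡⟨ cong₂ _+_ (cong₂ _+_ weighted-all-ones
                                (trans (weighted-row X rows Z) (cong (q *_) ∑-in-first-block)))
                     (trans (weighted-col X cols Z) (cong (q *_) ∑-in-first-block)) ⟩
      suc k * (q * q) + q * q + q * q
        ≡⟨ [1+k]*x+x+x≡x+[2+k]*x k (q * q) ⟩
      q * q + d * (q * q) ∎

    by-identity : weighted X W ≡ d * M + d * (q * q)
    by-identity = begin
      weighted X W
        ≡⟨ sum-cong-≗ {n} (λ r → sum-cong-≗ {n} (λ c →
             cong (X r c *_) (σ-identity (block-< r) (block-< c)))) ⟩
      weighted X (λ r c → d * (Z r * Z c) + 1)
        ≡⟨ weighted-+ X (λ r c → d * (Z r * Z c)) (λ _ _ → 1) ⟩
      weighted X (λ r c → d * (Z r * Z c)) + weighted X (λ _ _ → 1)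
        ≡⟨ cong₂ _+_ (weighted-* X d (λ r c → Z r * Z c))
                     (trans (weighted-row X rows (λ _ → 1)) (cong (q *_) (∑-const n 1))) ⟩
      d * M + q * (n * 1)
        ≡⟨ cong (d * M +_) (q*[q*d*1]≡d*[q*q] q d) ⟩
      d * M + d * (q * q) ∎

    q*q≡d*M : q * q ≡ d * M
    q*q≡d*M = +-cancelʳ-≡ (d * (q * q)) _ _ (trans (sym by-overlaps) by-identity)

  orthogonal-mate⇒d∣q*q : (A : Fin n → Fin n → Fin 2) → IsFreqSquare (binarySq (n ∸ q) q A) →
                          (∀ (t : Fin (suc k)) → Orthogonal (binarySq (n ∸ q) q A) (F (toℕ t))) → d ∣ q * q
  orthogonal-mate⇒d∣q*q A (_ , _ , _ , rowsA , colsA) orthogonal = d∣q*q X rows cols overlaps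
    where
    open ≡-Reasoning
    X : Fin n → Fin n → ℕ
    X r c = 𝟙 ⌊ A r c ≟ 1F ⌋

    rows : ∀ r → ∑[ c < n ] X r c ≡ q
    rows r = trans (sym (count≡∑ (λ c → ⌊ A r c ≟ 1F ⌋))) (rowsA r 1F)

    cols : ∀ c → ∑[ r < n ] X r c ≡ q
    cols c = trans (sym (count≡∑ (λ r → ⌊ A r c ≟ 1F ⌋))) (colsA c 1F)

    overlaps : ∀ t → weighted X (λ r c → 𝟙 (ones (toℕ t) r c)) ≡ q * q
    overlaps t = begin
      weighted X (λ r c → 𝟙 (ones (toℕ t) r c))
        ≡⟨ sum-cong-≗ {n} (λ r → sum-cong-≗ {n} (λ c → trans (sym (𝟙-∧ _ (ones (toℕ t) r c)))
             (cong (λ b → 𝟙 (⌊ A r c ≟ 1F ⌋ ∧ b)) (sym (bit-≟-1F (ones (toℕ t) r c)))))) ⟩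
      ∑[ r < n ] ∑[ c < n ] 𝟙 (⌊ A r c ≟ 1F ⌋ ∧ ⌊ arr (F (toℕ t)) r c ≟ 1F ⌋)
        ≡⟨ countCells≡∑∑ (λ r c → ⌊ A r c ≟ 1F ⌋ ∧ ⌊ arr (F (toℕ t)) r c ≟ 1F ⌋) ⟨
      countCells (λ r c → ⌊ A r c ≟ 1F ⌋ ∧ ⌊ arr (F (toℕ t)) r c ≟ 1F ⌋)
        ≡⟨ orthogonal t 1F 1F ⟩
      q * q ∎

  isMOFS : IsMOFS (family n d q)
  isMOFS = (λ t → isFreqSquare-F (toℕ t))
         , (λ s t s≢t → orthogonal-F (toℕ<n s) (toℕ<n t) (s≢t ∘ toℕ-injective))

  typeMaximal : (∃[ p ] (Prime p × p ∣ d × p ∤ q)) → TypeMaximal (family n d q)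
  typeMaximal (p , p-prime , p∣d , p∤q) (record { arr = A } , isFreqSquare-G , orthogonal , _ , refl) =
    [ p∤q , p∤q ] (euclidsLemma q q p-prime
                     (∣-trans p∣d (orthogonal-mate⇒d∣q*q A isFreqSquare-G orthogonal)))

theorem2p4 : (n d : ℕ) → 0 < n → 1 < d → (dn : d ∣ n) →
    IsMOFS (family n d (_∣_.quotient dn)) ×
    ((∃[ p ] (Prime p × p ∣ d × p ∤ _∣_.quotient dn)) →
      TypeMaximal (family n d (_∣_.quotient dn)))
theorem2p4 _ (suc (suc k)) _  (s≤s (s≤s _)) (divides (suc q′) refl) =
  BlowUp.isMOFS q′ k , BlowUp.typeMaximal q′ k
theorem2p4 _ (suc (suc k)) () (s≤s (s≤s _)) (divides zero refl)
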